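{- Let $(m,n)$ be a coprime pair of positive integers, let $\Sigma$ be the $(S,W)$-word of some $D\in\mathcal D_{m,n}$, and let $R^{(0)}$ be a weakly increasing sequence of $m+n$ nonnegative integers. Then: (i) In any path diagram $T(\Sigma,R)$ produced by the WeakFindRank algorithm started at $R^{(0)}$, if row $j$ is the lowest row with $c(j)>0$, then there is an arrow starting at level $j$. (ii) The successive rank sequences produced by the WeakFindRank algorithm are all weakly increasing. (iii) If a path diagram $T(\Sigma,R)$ has no positive row counts, then it is balanced. Consequently, if the WeakFindRank algorithm terminates, its last path diagram is balanced.
   Context: $(m,n)$-Dyck paths: lattice paths from $(0,0)$ to $(m,n)$ with $n$ North and $m$ East unit steps staying weakly above $y=nx/m$; $\mathcal D_{m,n}$ is their set. The $(S,W)$-word of a path writes $S$ for each North step and $W$ for each East step. Path diagram $T(\Sigma,R)$ for a word $\Sigma=\Sigma_1\cdots\Sigma_{m+n}$ with $n$ letters $S$ and $m$ letters $W$ and an integer sequence $R=(r_1,\dots,r_{m+n})$: arrows $A_1,\dots,A_{m+n}$, where $A_i$ goes from $(i-1,r_i)$ to $(i,r_i+m)$ (red) if $\Sigma_i=S$ and from $(i-1,r_i)$ to $(i,r_i-n)$ (blue) if $\Sigma_i=W$; $r_i$ is the starting rank of $A_i$ and $A_i$ starts at level $r_i$. Row $j$ ($j\in\mathbb Z$) is the strip between $y=j$ and $y=j+1$; a red arrow with starting rank $r$ has a segment in rows $r,\dots,r+m-1$, a blue one in rows $r-n,\dots,r-1$. The row count is $c(j)=c^r(j)-c^b(j)$,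 the number of red minus the number of blue arrows having a segment in row $j$. $T(\Sigma,R)$ is balanced if all row counts vanish. WeakFindRank algorithm: start with $R=R^{(0)}$. Repeat: if all row counts of $T(\Sigma,R)$ are $\le 0$, stop and output $R$. Otherwise let $j$ be the lowest row with $c(j)>0$, let $i$ be the largest index with $r_i=j$ (the rightmost arrow starting at level $j$), and replace $r_i$ by $r_i+1$, keeping the other entries. -}

module Defs where

open import Data.Nat as ℕ using (ℕ; zero; suc)
open import Data.Integer as ℤ using (ℤ; +_; _≤ᵇ_)
open import Data.Bool using (Bool; true; false; _∧_; if_then_else_)
open import Data.Fin using (Fin)
import Data.Fin as Fin
open import Data.List using (List; []; _∷_; length; take; lookup; map; allFin)
open import Data.Nat.ListAction using (sum)
open import Data.Product using (Σ; _×_; ∃)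
open import Relation.Binary.PropositionalEquality using (_≡_; _≢_)
open import Relation.Binary.Construct.Closure.ReflexiveTransitive using (Star)

-- Letters of an (S,W)-word: S = North step, W = East step.
data Letter : Set where
  S W : Letter

countS : List Letter → ℕ
countS []      = zero
countS (S ∷ w) = suc (countS w)
countS (W ∷ w) = countS w

countW : List Letter → ℕ
countW []      = zero
countW (S ∷ w) = countW w
countW (W ∷ w) = suc (countW w)

-- w is the (S,W)-word of an (m,n)-Dyck path: n letters S, m letters W, and
-- every prefix (a North steps, b East steps, i.e. the point (b,a)) satisfies
-- a ≥ n b / m, i.e. n * b ≤ m * a.
IsDyckWord : ℕ → ℕ → List Letter → Set
IsDyckWord m n w =
  countS w ≡ n × countW w ≡ m ×
  (∀ k → n ℕ.* countW (take k w) ℕ.≤ m ℕ.* countS (take k w))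

Ranks : List Letter → Set
Ranks w = Fin (length w) → ℤ

_<ᵇ_ : ℤ → ℤ → Bool
j <ᵇ x = (j ℤ.+ ℤ.1ℤ) ≤ᵇ x

redIn : ℕ → (w : List Letter) → Ranks w → ℤ → Fin (length w) → Bool
redIn m w R j i with lookup w i
... | S = (R i ≤ᵇ j) ∧ (j <ᵇ (R i ℤ.+ + m))
... | W = false

blueIn : ℕ → (w : List Letter) → Ranks w → ℤ → Fin (length w) → Bool
blueIn n w R j i with lookup w i
... | S = false
... | W = ((R i ℤ.- + n) ≤ᵇ j) ∧ (j <ᵇ R i)

count : ∀ {N : ℕ} → (Fin N → Bool) → ℕ
count {N} p = sum (map (λ i → if p i then 1 else 0) (allFin N))

redCount : ℕ → (w : List Letter) → Ranks w → ℤ → ℕ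
redCount m w R j = count (redIn m w R j)

blueCount : ℕ → (w : List Letter) → Ranks w → ℤ → ℕ
blueCount n w R j = count (blueIn n w R j)

rowCount : ℕ → ℕ → (w : List Letter) → Ranks w → ℤ → ℤ
rowCount m n w R j = + redCount m w R j ℤ.- + blueCount n w R j

Balanced : ℕ → ℕ → (w : List Letter) → Ranks w → Set
Balanced m n w R = ∀ j → rowCount m n w R j ≡ + 0

WeaklyIncreasing : ∀ {N} → (Fin N → ℤ) → Set
WeaklyIncreasing {N} R = ∀ (i i' : Fin N) → i Fin.≤ i' → R i ℤ.≤ R i'

NonNegative : ∀ {N} → (Fin N → ℤ) → Set
NonNegative {N} R = ∀ (i : Fin N) → + 0 ℤ.≤ R i

LowestPositiveRow : ℕ → ℕ → (w : List Letter) → Ranks w → ℤ → Set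
LowestPositiveRow m n w R j =
  + 0 ℤ.< rowCount m n w R j × (∀ k → k ℤ.< j → rowCount m n w R k ℤ.≤ + 0)

WFRStep : ℕ → ℕ → (w : List Letter) → Ranks w → Ranks w → Set
WFRStep m n w R R' =
  Σ ℤ λ j → LowestPositiveRow m n w R j ×
  Σ (Fin (length w)) λ i → R i ≡ j × (∀ i' → R i' ≡ j → i' Fin.≤ i) ×
    R' i ≡ R i ℤ.+ ℤ.1ℤ × (∀ i' → i' ≢ i → R' i' ≡ R i')

Produced : ℕ → ℕ → (w : List Letter) → Ranks w → Ranks w → Set
Produced m n w R0 R = Star (WFRStep m n w) R0 R

module Submission where

-- (i) If no arrow starts at level j, every red arrow with a segment in row j also has one in
-- row j − 1, and every blue arrow with a segment in row j − 1 also has one in row j; hence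
-- c(j) ≤ c(j − 1), which is ≤ 0 when j is the lowest row with c(j) > 0.
-- (ii) Raising the rightmost arrow at its level by one keeps the ranks weakly increasing.
-- (iii) Summed over all rows, each of the n red arrows contributes m and each of the m blue
-- arrows contributes −n, so the row counts add up to mn − nm = 0; row counts that are all
-- ≤ 0 and add up to 0 vanish. Summing over a finite window of rows containing every arrow
-- makes this precise.

open import Defs
open import Data.Bool using (Bool; true; false; T; _∧_; if_then_else_)
import Data.Bool.Properties as BoolP
open import Data.Empty using (⊥-elim)
open import Data.Fin as Fin using (Fin; toℕ; fromℕ<)
import Data.Fin.Properties as FinP
open import Data.Integer as ℤ using (ℤ; +_; -[1+_]; +≤+; _≤ᵇ_; pred; ∣_∣)
import Data.Integer.Properties as ℤP
open import Data.Integer.Tactic.RingSolver using (solve-∀)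
open import Data.List using (List; []; _∷_; length; lookup; map; tabulate)
open import Data.Nat as ℕ using (ℕ; zero; suc; _+_; _*_; _∸_; z≤n; s≤s)
open import Data.Nat.Coprimality using (Coprime)
import Data.Nat.ListAction as Listℕ
import Data.Nat.Properties as ℕP
open import Data.Product using (_×_; _,_; proj₁; proj₂; ∃; ∃₂)
open import Function using (_∘_; id)
open import Function.Bundles using (Equivalence)
open import Relation.Binary.Construct.Closure.ReflexiveTransitive using (ε; _◅_)
open import Relation.Binary.PropositionalEquality
open import Relation.Nullary using (yes; no)

open import Algebra.Properties.CommutativeMonoid.Sum ℕP.+-0-commutativeMonoid
  using (sum; sum-syntax; ∑-comm; sum-cong-≗; sum-replicate-zero)

ind : Bool → ℕ
ind b = if b then 1 else 0

ind-mono : ∀ {a b} → (T a → T b) → ind a ℕ.≤ ind b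
ind-mono {false}         _   = z≤n
ind-mono {true}  {true}  _   = ℕP.≤-refl
ind-mono {true}  {false} a⇒b = ⊥-elim (a⇒b _)

sum-map-tabulate : ∀ {A : Set} {N} (f : A → ℕ) (g : Fin N → A) →
                   Listℕ.sum (map f (tabulate g)) ≡ ∑[ i < N ] f (g i)
sum-map-tabulate {N = zero}  f g = refl
sum-map-tabulate {N = suc N} f g = cong (λ s → f (g Fin.zero) + s) (sum-map-tabulate f (g ∘ Fin.suc))

∑-cong : ∀ N {f g : Fin N → ℕ} → (∀ i → f i ≡ g i) → ∑[ i < N ] f i ≡ ∑[ i < N ] g i
∑-cong N = sum-cong-≗

count≡∑ : ∀ {N} (p : Fin N → Bool) → count p ≡ ∑[ i < N ] ind (p i)
count≡∑ p = sum-map-tabulate (ind ∘ p) (λ i → i)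

∑-mono-≤ : ∀ {N} {f g : Fin N → ℕ} → (∀ i → f i ℕ.≤ g i) → sum f ℕ.≤ sum g
∑-mono-≤ {zero}  f≤g = z≤n
∑-mono-≤ {suc N} f≤g = ℕP.+-mono-≤ (f≤g Fin.zero) (∑-mono-≤ (f≤g ∘ Fin.suc))

+-mono-≤-≡ : ∀ {a b c d} → a ℕ.≤ c → b ℕ.≤ d → a + b ≡ c + d → a ≡ c × b ≡ d
+-mono-≤-≡ {a} {b} {c} {d} a≤c b≤d a+b≡c+d =
  a≡c , ℕP.+-cancelˡ-≡ c b d (subst (λ x → x + b ≡ c + d) a≡c a+b≡c+d)
  where
  c+b≤a+b : c + b ℕ.≤ a + b
  c+b≤a+b = subst (c + b ℕ.≤_) (sym a+b≡c+d) (ℕP.+-monoʳ-≤ c b≤d)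
  a≡c : a ≡ c
  a≡c = ℕP.≤-antisym a≤c (ℕP.+-cancelʳ-≤ b c a c+b≤a+b)

∑-≤-≡⇒≗ : ∀ {N} {f g : Fin N → ℕ} → (∀ i → f i ℕ.≤ g i) → sum f ≡ sum g → ∀ i → f i ≡ g i
∑-≤-≡⇒≗ {suc N} f≤g ∑f≡∑g Fin.zero    =
  proj₁ (+-mono-≤-≡ (f≤g Fin.zero) (∑-mono-≤ (f≤g ∘ Fin.suc)) ∑f≡∑g)
∑-≤-≡⇒≗ {suc N} f≤g ∑f≡∑g (Fin.suc i) =
  ∑-≤-≡⇒≗ (f≤g ∘ Fin.suc) (proj₂ (+-mono-≤-≡ (f≤g Fin.zero) (∑-mono-≤ (f≤g ∘ Fin.suc)) ∑f≡∑g)) i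

≡-fromT : ∀ {a b} → (T a → T b) → (T b → T a) → a ≡ b
≡-fromT {false} {false} _   _   = refl
≡-fromT {false} {true}  _   b⇒a = ⊥-elim (b⇒a _)
≡-fromT {true}  {false} a⇒b _   = ⊥-elim (a⇒b _)
≡-fromT {true}  {true}  _   _   = refl

inRange : ℕ → ℕ → ℕ → Bool
inRange a b k = (a ℕ.≤ᵇ k) ∧ (k ℕ.<ᵇ b)

inRange-suc : ∀ a b k → inRange (suc a) (suc b) (suc k) ≡ inRange a b k
inRange-suc zero    b k = refl
inRange-suc (suc a) b k = refl

∑-inRange : ∀ a b K → b ℕ.≤ K → ∑[ k < K ] ind (inRange a b (toℕ k)) ≡ b ∸ a
∑-inRange a zero K _ = begin
  ∑[ k < K ] ind (inRange a 0 (toℕ k))  ≡⟨ ∑-cong K (λ k → cong ind (BoolP.∧-zeroʳ (a ℕ.≤ᵇ toℕ k))) ⟩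
  ∑[ k < K ] 0                          ≡⟨ sum-replicate-zero K ⟩
  0                                     ≡⟨ ℕP.0∸n≡0 a ⟨
  0 ∸ a                                 ∎
  where open ≡-Reasoning
∑-inRange zero    (suc b) (suc K) (s≤s b≤K) = cong suc (∑-inRange zero b K b≤K)
∑-inRange (suc a) (suc b) (suc K) (s≤s b≤K) =
  trans (∑-cong K (λ k → cong ind (inRange-suc a b (toℕ k)))) (∑-inRange a b K b≤K)

-- redIn and blueIn unfold to inInterval (R i) (R i + m) and inInterval (R i − n) (R i).
inInterval : ℤ → ℤ → ℤ → Bool
inInterval lo hi j = (lo ≤ᵇ j) ∧ (j <ᵇ hi)

+-cancelˡ-≤ : ∀ L {i j} → L ℤ.+ i ℤ.≤ L ℤ.+ j → i ℤ.≤ j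
+-cancelˡ-≤ L {i} {j} L+i≤L+j =
  subst₂ ℤ._≤_ (-L+[L+i]≡i L i) (-L+[L+i]≡i L j) (ℤP.+-monoʳ-≤ (ℤ.- L) L+i≤L+j)
  where
  -L+[L+i]≡i : ∀ L i → ℤ.- L ℤ.+ (L ℤ.+ i) ≡ i
  -L+[L+i]≡i = solve-∀

≤ᵇ-shift : ∀ L x y → (L ℤ.+ + x ≤ᵇ L ℤ.+ + y) ≡ (x ℕ.≤ᵇ y)
≤ᵇ-shift L x y = ≡-fromT
  (λ t → ℕP.≤⇒≤ᵇ (ℤP.drop‿+≤+ (+-cancelˡ-≤ L (ℤP.≤ᵇ⇒≤ t))))
  (λ t → ℤP.≤⇒≤ᵇ (ℤP.+-monoʳ-≤ L (+≤+ (ℕP.≤ᵇ⇒≤ x y t))))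

inInterval-shift : ∀ L a b k → inInterval (L ℤ.+ + a) (L ℤ.+ + b) (L ℤ.+ + k) ≡ inRange a b k
inInterval-shift L a b k = cong₂ _∧_ (≤ᵇ-shift L a k)
  (trans (cong (_≤ᵇ L ℤ.+ + b) L+k+1≡L+[1+k]) (≤ᵇ-shift L (suc k) b))
  where
  L+k+1≡L+[1+k] : L ℤ.+ + k ℤ.+ ℤ.1ℤ ≡ L ℤ.+ + suc k
  L+k+1≡L+[1+k] = trans (ℤP.+-assoc L (+ k) ℤ.1ℤ) (cong (λ x → L ℤ.+ + x) (ℕP.+-comm k 1))

∑-inInterval : ∀ L {lo hi} a b K → lo ≡ L ℤ.+ + a → hi ≡ L ℤ.+ + b → b ℕ.≤ K →
               ∑[ k < K ] ind (inInterval lo hi (L ℤ.+ + toℕ k)) ≡ b ∸ a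
∑-inInterval L a b K refl refl b≤K =
  trans (∑-cong K (λ k → cong ind (inInterval-shift L a b (toℕ k)))) (∑-inRange a b K b≤K)

<ᵇ⇒< : ∀ {j k} → T (j <ᵇ k) → j ℤ.< k
<ᵇ⇒< {j} t = ℤP.suc[i]≤j⇒i<j (subst (ℤ._≤ _) (ℤP.+-comm j ℤ.1ℤ) (ℤP.≤ᵇ⇒≤ t))

<⇒+1≤ : ∀ {j k} → j ℤ.< k → j ℤ.+ ℤ.1ℤ ℤ.≤ k
<⇒+1≤ {j} j<k = subst (ℤ._≤ _) (ℤP.+-comm ℤ.1ℤ j) (ℤP.i<j⇒suc[i]≤j j<k)

<⇒<ᵇ : ∀ {j k} → j ℤ.< k → T (j <ᵇ k)
<⇒<ᵇ j<k = ℤP.≤⇒≤ᵇ (<⇒+1≤ j<k)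

inInterval⁻ : ∀ {lo hi j} → T (inInterval lo hi j) → lo ℤ.≤ j × j ℤ.< hi
inInterval⁻ {lo} {hi} {j} t with Equivalence.to (BoolP.T-∧ {lo ≤ᵇ j}) t
... | lo≤j , j<hi = ℤP.≤ᵇ⇒≤ lo≤j , <ᵇ⇒< j<hi

inInterval⁺ : ∀ {lo hi j} → lo ℤ.≤ j → j ℤ.< hi → T (inInterval lo hi j)
inInterval⁺ lo≤j j<hi = Equivalence.from BoolP.T-∧ (ℤP.≤⇒≤ᵇ lo≤j , <⇒<ᵇ j<hi)

pred[j]<j : ∀ j → pred j ℤ.< j
pred[j]<j j = ℤP.i≤pred[j]⇒i<j ℤP.≤-refl

inInterval-pred : ∀ {lo hi j} → lo ≢ j → T (inInterval lo hi j) → T (inInterval lo hi (pred j))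
inInterval-pred {lo} {hi} {j} lo≢j t with inInterval⁻ {lo} {hi} t
... | lo≤j , j<hi =
  inInterval⁺ {lo} {hi} (ℤP.i<j⇒i≤pred[j] (ℤP.≤∧≢⇒< lo≤j lo≢j)) (ℤP.<-trans (pred[j]<j j) j<hi)

inInterval-from-pred : ∀ {lo hi j} → hi ≢ j → T (inInterval lo hi (pred j)) → T (inInterval lo hi j)
inInterval-from-pred {lo} {hi} {j} hi≢j t with inInterval⁻ {lo} {hi} t
... | lo≤pred[j] , pred[j]<hi =
  inInterval⁺ {lo} {hi} (ℤP.≤-trans lo≤pred[j] (ℤP.<⇒≤ (pred[j]<j j)))
              (ℤP.≤∧≢⇒< (subst (ℤ._≤ _) (ℤP.suc-pred j) (ℤP.i<j⇒suc[i]≤j pred[j]<hi)) (hi≢j ∘ sym))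

redIn-pred : ∀ m w R j i → R i ≢ j → T (redIn m w R j i) → T (redIn m w R (pred j) i)
redIn-pred m w R j i Ri≢j with lookup w i
... | S = inInterval-pred {R i} {R i ℤ.+ + m} Ri≢j
... | W = λ ()

blueIn-from-pred : ∀ n w R j i → R i ≢ j → T (blueIn n w R (pred j) i) → T (blueIn n w R j i)
blueIn-from-pred n w R j i Ri≢j with lookup w i
... | S = λ ()
... | W = inInterval-from-pred {R i ℤ.- + n} {R i} Ri≢j

count-mono : ∀ {N} {p q : Fin N → Bool} → (∀ i → T (p i) → T (q i)) → count p ℕ.≤ count q
count-mono {p = p} {q} p⇒q =
  subst₂ ℕ._≤_ (sym (count≡∑ p)) (sym (count≡∑ q)) (∑-mono-≤ (λ i → ind-mono (p⇒q i)))

rowCount-≤-pred : ∀ m n w R j → (∀ i → R i ≢ j) → rowCount m n w R j ℤ.≤ rowCount m n w R (pred j)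
rowCount-≤-pred m n w R j no-start = ℤP.+-mono-≤
  (+≤+ (count-mono (λ i → redIn-pred m w R j i (no-start i))))
  (ℤP.neg-mono-≤ (+≤+ (count-mono (λ i → blueIn-from-pred n w R j i (no-start i)))))

lowestPositiveRow-starts : ∀ m n w R j → LowestPositiveRow m n w R j → ∃ λ i → R i ≡ j
lowestPositiveRow-starts m n w R j (0<c[j] , below-j) with FinP.any? (λ i → R i ℤP.≟ j)
... | yes start = start
... | no ¬start = ⊥-elim (ℤP.<⇒≱ 0<c[j] (ℤP.≤-trans
        (rowCount-≤-pred m n w R j (λ i Ri≡j → ¬start (i , Ri≡j)))
        (below-j (pred j) (pred[j]<j j))))

increment-rightmost-weaklyIncreasing :
  ∀ {N} {f f′ : Fin N → ℤ} {i : Fin N} → WeaklyIncreasing f →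
  (∀ i′ → f i′ ≡ f i → i′ Fin.≤ i) → f′ i ≡ f i ℤ.+ ℤ.1ℤ → (∀ i′ → i′ ≢ i → f′ i′ ≡ f i′) →
  WeaklyIncreasing f′
increment-rightmost-weaklyIncreasing {f = f} {f′} {i} mono rightmost f′i≡ f′≡ a b a≤b
  with a Fin.≟ i | b Fin.≟ i
... | yes refl | yes refl = ℤP.≤-refl
... | no a≢i   | no b≢i   = subst₂ ℤ._≤_ (sym (f′≡ a a≢i)) (sym (f′≡ b b≢i)) (mono a b a≤b)
... | no a≢i   | yes refl =
  subst₂ ℤ._≤_ (sym (f′≡ a a≢i)) (sym f′i≡) (ℤP.≤-trans (mono a b a≤b) (ℤP.i≤i+j (f b) ℤ.1ℤ))
... | yes refl | no b≢i   = subst₂ ℤ._≤_ (sym f′i≡) (sym (f′≡ b b≢i)) (<⇒+1≤ fa<fb)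
  where
  fa<fb : f a ℤ.< f b
  fa<fb = ℤP.≤∧≢⇒< (mono a b a≤b) (λ fa≡fb → b≢i (FinP.≤-antisym (rightmost b (sym fa≡fb)) a≤b))

step-weaklyIncreasing : ∀ m n w {R R′} → WFRStep m n w R R′ → WeaklyIncreasing R → WeaklyIncreasing R′
step-weaklyIncreasing m n w (j , _ , i , Ri≡j , rightmost , R′i≡ , R′≡) mono =
  increment-rightmost-weaklyIncreasing mono (λ i′ Ri′≡Ri → rightmost i′ (trans Ri′≡Ri Ri≡j)) R′i≡ R′≡

produced-weaklyIncreasing : ∀ m n w {R₀ R} → Produced m n w R₀ R → WeaklyIncreasing R₀ → WeaklyIncreasing R
produced-weaklyIncreasing m n w ε                = id
produced-weaklyIncreasing m n w (step ◅ steps) =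
  produced-weaklyIncreasing m n w steps ∘ step-weaklyIncreasing m n w step

∑-≥-term : ∀ {N} (f : Fin N → ℕ) i → f i ℕ.≤ sum f
∑-≥-term f Fin.zero    = ℕP.m≤m+n _ _
∑-≥-term f (Fin.suc i) = ℕP.≤-trans (∑-≥-term (f ∘ Fin.suc) i) (ℕP.m≤n+m _ _)

-- Offsets are measured from L + n, so that blue arrows, which reach n rows below their
-- starting rank, also stay among the rows L, …, L + K − 1.
ArrowsWithin : ℕ → ℕ → (w : List Letter) → Ranks w → ℤ → ℕ → Set
ArrowsWithin m n w R L K = ∀ i → ∃ λ a → R i ≡ L ℤ.+ + (n + a) × n + a + m ℕ.≤ K

redHeight : ℕ → Letter → ℕ
redHeight m S = m
redHeight m W = 0

blueHeight : ℕ → Letter → ℕ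
blueHeight n S = 0
blueHeight n W = n

∑-redIn : ∀ m n w R L K → ArrowsWithin m n w R L K → ∀ i →
          ∑[ k < K ] ind (redIn m w R (L ℤ.+ + toℕ k) i) ≡ redHeight m (lookup w i)
∑-redIn m n w R L K within i with lookup w i | within i
... | W | _ = sum-replicate-zero K
... | S | a , Ri≡ , fits =
  trans (∑-inInterval L (n + a) (n + a + m) K Ri≡ (trans (cong (ℤ._+ + m) Ri≡) (ℤP.+-assoc L _ _)) fits)
        (ℕP.m+n∸m≡n (n + a) m)

∑-blueIn : ∀ m n w R L K → ArrowsWithin m n w R L K → ∀ i →
           ∑[ k < K ] ind (blueIn n w R (L ℤ.+ + toℕ k) i) ≡ blueHeight n (lookup w i)
∑-blueIn m n w R L K within i with lookup w i | within i
... | S | _ = sum-replicate-zero K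
... | W | a , Ri≡ , fits =
  trans (∑-inInterval L a (n + a) K (trans (cong (ℤ._- + n) Ri≡) (L+[n+a]-n≡L+a L (+ n) (+ a))) Ri≡
                      (ℕP.m+n≤o⇒m≤o (n + a) fits))
        (ℕP.m+n∸n≡m n a)
  where
  L+[n+a]-n≡L+a : ∀ L n a → L ℤ.+ (n ℤ.+ a) ℤ.- n ≡ L ℤ.+ a
  L+[n+a]-n≡L+a = solve-∀

∑-redHeight : ∀ m w → ∑[ i < length w ] redHeight m (lookup w i) ≡ m * countS w
∑-redHeight m []      = sym (ℕP.*-zeroʳ m)
∑-redHeight m (S ∷ w) = trans (cong (λ s → m + s) (∑-redHeight m w)) (sym (ℕP.*-suc m (countS w)))
∑-redHeight m (W ∷ w) = ∑-redHeight m w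

∑-blueHeight : ∀ n w → ∑[ i < length w ] blueHeight n (lookup w i) ≡ n * countW w
∑-blueHeight n []      = sym (ℕP.*-zeroʳ n)
∑-blueHeight n (S ∷ w) = ∑-blueHeight n w
∑-blueHeight n (W ∷ w) = trans (cong (λ s → n + s) (∑-blueHeight n w)) (sym (ℕP.*-suc n (countW w)))

∑-redCount : ∀ m n w R L K → ArrowsWithin m n w R L K →
             ∑[ k < K ] redCount m w R (L ℤ.+ + toℕ k) ≡ m * countS w
∑-redCount m n w R L K within = begin
  ∑[ k < K ] redCount m w R (row k)           ≡⟨ ∑-cong K (λ k → count≡∑ (redIn m w R (row k))) ⟩
  ∑[ k < K ] ∑[ i < length w ] χ k i          ≡⟨ ∑-comm χ ⟩
  ∑[ i < length w ] ∑[ k < K ] χ k i          ≡⟨ ∑-cong (length w) (∑-redIn m n w R L K within) ⟩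
  ∑[ i < length w ] redHeight m (lookup w i)  ≡⟨ ∑-redHeight m w ⟩
  m * countS w                                ∎
  where
  open ≡-Reasoning
  row : Fin K → ℤ
  row k = L ℤ.+ + toℕ k
  χ : Fin K → Fin (length w) → ℕ
  χ k i = ind (redIn m w R (row k) i)

∑-blueCount : ∀ m n w R L K → ArrowsWithin m n w R L K →
              ∑[ k < K ] blueCount n w R (L ℤ.+ + toℕ k) ≡ n * countW w
∑-blueCount m n w R L K within = begin
  ∑[ k < K ] blueCount n w R (row k)           ≡⟨ ∑-cong K (λ k → count≡∑ (blueIn n w R (row k))) ⟩
  ∑[ k < K ] ∑[ i < length w ] χ k i           ≡⟨ ∑-comm χ ⟩
  ∑[ i < length w ] ∑[ k < K ] χ k i           ≡⟨ ∑-cong (length w) (∑-blueIn m n w R L K within) ⟩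
  ∑[ i < length w ] blueHeight n (lookup w i)  ≡⟨ ∑-blueHeight n w ⟩
  n * countW w                                 ∎
  where
  open ≡-Reasoning
  row : Fin K → ℤ
  row k = L ℤ.+ + toℕ k
  χ : Fin K → Fin (length w) → ℕ
  χ k i = ind (blueIn n w R (row k) i)

∣x∣≤B⇒-B+offset : ∀ B x → ∣ x ∣ ℕ.≤ B → ∃ λ a → x ≡ ℤ.- + B ℤ.+ + a × a ℕ.≤ B + B
∣x∣≤B⇒-B+offset B (+ c) c≤B = B + c , x≡-y+[y+x] (+ B) (+ c) , ℕP.+-monoʳ-≤ B c≤B
  where
  x≡-y+[y+x] : ∀ y x → x ≡ ℤ.- y ℤ.+ (y ℤ.+ x)
  x≡-y+[y+x] = solve-∀
∣x∣≤B⇒-B+offset B -[1+ c ] 1+c≤B =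
  B ∸ suc c , -[1+c]≡ , ℕP.≤-trans (ℕP.m∸n≤m B (suc c)) (ℕP.m≤m+n B B)
  where
  -x≡-y+[y-x] : ∀ y x → ℤ.- x ≡ ℤ.- y ℤ.+ (y ℤ.- x)
  -x≡-y+[y-x] = solve-∀
  -[1+c]≡ : -[1+ c ] ≡ ℤ.- + B ℤ.+ + (B ∸ suc c)
  -[1+c]≡ = trans (-x≡-y+[y-x] (+ B) (+ suc c))
    (cong (λ x → ℤ.- + B ℤ.+ x) (trans (ℤP.m-n≡m⊖n B (suc c)) (ℤP.⊖-≥ 1+c≤B)))

arrowsWithin-around : ∀ m n w R j →
  ∃₂ λ L K → ArrowsWithin m n w R L K × ∃ λ (k : Fin K) → j ≡ L ℤ.+ + toℕ k
arrowsWithin-around m n w R j = L , K , within , fromℕ< k<K , j≡L+k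
  where
  B = ∑[ i < length w ] ∣ R i ∣ + ∣ j ∣
  L = ℤ.- + (n + B)
  K = n + (B + B) + suc m
  -B+a≡L+[n+a] : ∀ a → ℤ.- + B ℤ.+ + a ≡ L ℤ.+ + (n + a)
  -B+a≡L+[n+a] a = -y+a≡-[x+y]+[x+a] (+ n) (+ B) (+ a)
    where
    -y+a≡-[x+y]+[x+a] : ∀ x y a → ℤ.- y ℤ.+ a ≡ ℤ.- (x ℤ.+ y) ℤ.+ (x ℤ.+ a)
    -y+a≡-[x+y]+[x+a] = solve-∀
  n+a<K : ∀ {a} → a ℕ.≤ B + B → n + a ℕ.< K
  n+a<K a≤2B = ℕP.≤-<-trans (ℕP.+-monoʳ-≤ n a≤2B) (ℕP.m<m+n _ ℕP.0<1+n)
  within : ArrowsWithin m n w R L K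
  within i with ∣x∣≤B⇒-B+offset B (R i) (ℕP.≤-trans (∑-≥-term (λ i → ∣ R i ∣) i) (ℕP.m≤m+n _ ∣ j ∣))
  ... | a , Ri≡ , a≤2B = a , trans Ri≡ (-B+a≡L+[n+a] a) , ℕP.+-mono-≤ (ℕP.+-monoʳ-≤ n a≤2B) (ℕP.n≤1+n m)
  offset-j = ∣x∣≤B⇒-B+offset B j (ℕP.m≤n+m ∣ j ∣ _)
  k<K : n + proj₁ offset-j ℕ.< K
  k<K = n+a<K (proj₂ (proj₂ offset-j))
  j≡L+k : j ≡ L ℤ.+ + toℕ (fromℕ< k<K)
  j≡L+k = trans (proj₁ (proj₂ offset-j))
            (trans (-B+a≡L+[n+a] _) (cong (λ x → L ℤ.+ + x) (sym (FinP.toℕ-fromℕ< k<K))))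

nonPositive⇒balanced : ∀ m n w → countS w ≡ n → countW w ≡ m → ∀ R →
                       (∀ j → rowCount m n w R j ℤ.≤ + 0) → Balanced m n w R
nonPositive⇒balanced m n w #S≡n #W≡m R nonPositive j with arrowsWithin-around m n w R j
... | L , K , within , k , refl =
  ℤP.i≡j⇒i-j≡0 (cong +_ (∑-≤-≡⇒≗ red≤blue ∑red≡∑blue k))
  where
  red≤blue : ∀ k → redCount m w R (L ℤ.+ + toℕ k) ℕ.≤ blueCount n w R (L ℤ.+ + toℕ k)
  red≤blue k = ℤP.drop‿+≤+ (ℤP.i-j≤0⇒i≤j (nonPositive (L ℤ.+ + toℕ k)))
  ∑red≡∑blue : ∑[ k < K ] redCount m w R (L ℤ.+ + toℕ k) ≡ ∑[ k < K ] blueCount n w R (L ℤ.+ + toℕ k)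
  ∑red≡∑blue = begin
    ∑[ k < K ] redCount m w R (L ℤ.+ + toℕ k)   ≡⟨ ∑-redCount m n w R L K within ⟩
    m * countS w                                ≡⟨ cong₂ _*_ (sym #W≡m) #S≡n ⟩
    countW w * n                                ≡⟨ ℕP.*-comm (countW w) n ⟩
    n * countW w                                ≡⟨ ∑-blueCount m n w R L K within ⟨
    ∑[ k < K ] blueCount n w R (L ℤ.+ + toℕ k)  ∎
    where open ≡-Reasoning

lemma4 : (m n : ℕ) → 0 ℕ.< m → 0 ℕ.< n → Coprime m n →
         (w : List Letter) → IsDyckWord m n w →
         (R0 : Ranks w) → WeaklyIncreasing R0 → NonNegative R0 →
         ((R : Ranks w) → Produced m n w R0 R → (j : ℤ) →
            LowestPositiveRow m n w R j → ∃ λ i → R i ≡ j)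
         × ((R : Ranks w) → Produced m n w R0 R → WeaklyIncreasing R)
         × ((R : Ranks w) → (∀ j → rowCount m n w R j ℤ.≤ + 0) → Balanced m n w R)
         × ((R : Ranks w) → Produced m n w R0 R →
            (∀ j → rowCount m n w R j ℤ.≤ + 0) → Balanced m n w R)
lemma4 m n _ _ _ w (#S≡n , #W≡m , _) R0 R0-mono _ =
  (λ R _ → lowestPositiveRow-starts m n w R) ,
  (λ R produced → produced-weaklyIncreasing m n w produced R0-mono) ,
  nonPositive⇒balanced m n w #S≡n #W≡m ,
  (λ R _ → nonPositive⇒balanced m n w #S≡n #W≡m R)
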